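{- If $r$ is a $2n$-balanced rotor type, then $UD(r)\equiv_n DU(r)\equiv_n r$.
   Context: A rotor type is an infinite periodic sequence $r=(r^{(1)},r^{(2)},\dots)$ of states with fundamental period $|r|$; two rotor types are equivalent if one is obtained from the other by an injective relabeling of states. A two-state rotor type is written over $\{1,2\}$ (convention $r^{(1)}=1$). For $N\in\mathbb{N}$, a two-state rotor type $r$ is $N$-balanced if $N$ divides $|r|$ and for every $k\ge0$ the block $r^{(k,N)}=(r^{(kN+1)},\dots,r^{(kN+N)})$ contains equally many $1$'s and $2$'s. Two rotor types $r,r'$ are $n$-equivalent, $r\equiv_n r'$, if there is a rotor type $s$ equivalent to $r$ and using the same states as $r'$ such that for every $k\ge 0$ the blocks $r'^{(k,n)}$ and $s^{(k,n)}$ are equal as multisets. Rotor-router dynamics: at each non-target vertex $v$ there is a periodic sequence $e_v^{(1)},e_v^{(2)},\dots$ of out-edges; a particle starts at the source, on its $j$-th visit to $v$ leaves along $e_v^{(j)}$, and whenever it reaches a target it is returned to the source; the hitting sequence is the sequence of targets reached. The compressor for $r$ has non-target vertices $1$ (source), $2,3$ and targets $4,5$. On the $j$-th departure: from vertex $1$ the particle goes to vertex $2$ if $r^{(j)}=1$ and to vertex $3$ if $r^{(j)}=2$; from vertex $2$, in variant $U$ it goes to vertex $1$ if $r^{(j)}=1$ and to target $4$ if $r^{(j)}=2$, in variant $D$ to target $4$ if $r^{(j)}=1$ and to vertex $1$ if $r^{(j)}=2$; from vertex $3$ likewise with target $5$. $UD(r)$ (resp. $DU(r)$) is the hitting sequence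 with variant $U$ at vertex $2$ and $D$ at vertex $3$ (resp. $D$ at $2$ and $U$ at $3$), viewed as a rotor type. -}

module Defs where

open import Data.Nat using (ℕ; zero; suc; _+_; _*_; _<_)
open import Data.List using (List; []; _∷_; map; upTo)
open import Data.Maybe using (Maybe; just; nothing)
open import Data.Product using (Σ; _×_; _,_; ∃; ∃-syntax)
open import Relation.Binary.PropositionalEquality using (_≡_)
open import Relation.Nullary using (¬_)
open import Function.Definitions using (Injective)
open import Data.List.Relation.Binary.Permutation.Propositional using (_↭_)

-- Sequences are 0-indexed: s 0 is s^(1), s j is s^(j+1).
Seq : Set → Set
Seq A = ℕ → A

data Two : Set where
  one two : Two

data Tgt : Set where
  t4 t5 : Tgt

IsPeriod : {A : Set} → Seq A → ℕ → Set
IsPeriod s p = ∀ i → s (p + i) ≡ s i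

IsFundamentalPeriod : {A : Set} → Seq A → ℕ → Set
IsFundamentalPeriod s p =
  (0 < p) × IsPeriod s p × (∀ q → 0 < q → q < p → ¬ IsPeriod s q)

block : {A : Set} → Seq A → ℕ → ℕ → List A
block s N k = map (λ i → s (k * N + i)) (upTo N)

count : Two → List Two → ℕ
count a [] = 0
count one (one ∷ xs) = suc (count one xs)
count one (two ∷ xs) = count one xs
count two (one ∷ xs) = count two xs
count two (two ∷ xs) = suc (count two xs)

IsBalanced : ℕ → Seq Two → ℕ → Set
IsBalanced N r p =
  (Σ ℕ λ m → p ≡ m * N) × (∀ k → count one (block r N k) ≡ count two (block r N k))

NEquiv : {A B : Set} → Seq A → ℕ → Seq B → Set
NEquiv {A} {B} r n r' =
  Σ (A → B) λ f → Injective _≡_ _≡_ f ×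
    (∀ k → block (λ i → f (r i)) n k ↭ block r' n k)

data Variant : Set where
  U D : Variant

data Vertex : Set where
  v1 v2 v3 : Vertex

record Config : Set where
  constructor cfg
  field
    at : Vertex   -- current position of the particle (a non-target vertex)
    c1 c2 c3 : ℕ  -- number of departures so far from vertices 1, 2, 3

-- departure from vertex 2 (target t) or 3, in a given variant, using state a:
-- returns nothing if the particle goes back to vertex 1,
-- just t if it reaches the target t (and is then returned to the source).
leave : Variant → Tgt → Two → Maybe Tgt
leave U t one = nothing
leave U t two = just t
leave D t one = just t
leave D t two = nothing

step : Variant → Variant → Seq Two → Config → Config × Maybe Tgt
step x y r (cfg v1 a b c) with r a
... | one = cfg v2 (suc a) b c , nothing
... | two = cfg v3 (suc a) b c , nothing
step x y r (cfg v2 a b c) = cfg v1 a (suc b) c , leave x t4 (r b)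
step x y r (cfg v3 a b c) = cfg v1 a b (suc c) , leave y t5 (r c)

config : Variant → Variant → Seq Two → ℕ → Config
config x y r zero = cfg v1 0 0 0
config x y r (suc t) = Data.Product.proj₁ (step x y r (config x y r t))

output : Variant → Variant → Seq Two → ℕ → Maybe Tgt
output x y r t = Data.Product.proj₂ (step x y r (config x y r t))

hits : Variant → Variant → Seq Two → ℕ → ℕ
hits x y r zero = 0
hits x y r (suc t) with output x y r t
... | just _ = suc (hits x y r t)
... | nothing = hits x y r t

IsHitting : Variant → Variant → Seq Two → Seq Tgt → Set
IsHitting x y r h =
  ∀ m → ∃[ t ] (hits x y r t ≡ m × output x y r t ≡ just (h m))

-- Both compressors spend two steps per departure from the source, so after a departures from
-- vertex 1 the particle has left vertex 2 exactly P₁(a) times and vertex 3 exactly P₂(a) times,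
-- where P_c(m) is the number of c's among the first m states of r. Target 4 is hit when vertex 2
-- emits state 1 (variant D) or state 2 (variant U), so after a rounds DU(r) has hit targets 4 and 5
-- P₁(P₁(a)) and P₂(P₂(a)) times, and UD(r) has hit them P₂(P₁(a)) and P₁(P₂(a)) times.
-- For a 2n-balanced r, P_c(2kn) = kn, so after 2kn rounds the relabelled hitting sequences have
-- emitted kn symbols with exactly P_c(kn) copies of each state c, as r does: every block of
-- length n has the same letter counts, i.e. is a permutation of the corresponding block of r.
module Submission where

open import Defs
open import Algebra.Properties.CommutativeSemigroup using (interchange)
open import Data.Empty using (⊥-elim)
open import Data.List using (List; []; _∷_; _++_; map; upTo; applyUpTo; replicate; length)
open import Data.List.Properties using (map-∘; map-applyUpTo; length-map; length-applyUpTo)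
open import Data.List.Relation.Binary.Permutation.Propositional
  using (_↭_; ↭-refl; ↭-sym; ↭-trans; ↭-reflexive; prep)
open import Data.List.Relation.Binary.Permutation.Propositional.Properties using (map⁺; shift)
open import Data.Maybe using (Maybe; just; nothing)
open import Data.Maybe.Properties using (just-injective)
open import Data.Nat using (ℕ; zero; suc; _+_; _*_; _<_; _≤_; _≤′_; ≤′-reflexive; ≤′-step; _<?_; NonZero)
open import Data.Nat.Properties
open import Data.Product using (Σ; _×_; _,_; proj₁; proj₂)
open import Function using (_∘_; id)
open import Function.Definitions using (Injective)
open import Relation.Binary.Definitions using (tri<; tri≈; tri>)
open import Relation.Binary.PropositionalEquality
  using (_≡_; refl; sym; trans; cong; cong₂; subst; subst₂; module ≡-Reasoning)
open import Relation.Nullary using (yes; no)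

ind : Two → Two → ℕ
ind one one = 1
ind one two = 0
ind two one = 0
ind two two = 1

ind-one+two : ∀ y → ind one y + ind two y ≡ 1
ind-one+two one = refl
ind-one+two two = refl

count-∷ : ∀ c y ys → count c (y ∷ ys) ≡ ind c y + count c ys
count-∷ one one ys = refl
count-∷ one two ys = refl
count-∷ two one ys = refl
count-∷ two two ys = refl

count-one+two : ∀ xs → count one xs + count two xs ≡ length xs
count-one+two [] = refl
count-one+two (one ∷ xs) = cong suc (count-one+two xs)
count-one+two (two ∷ xs) = trans (+-suc (count one xs) _) (cong suc (count-one+two xs))

countUpTo : Two → Seq Two → ℕ → ℕ
countUpTo c s zero = 0
countUpTo c s (suc m) = ind c (s m) + countUpTo c s m

countUpTo-one+two : ∀ s m → countUpTo one s m + countUpTo two s m ≡ m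
countUpTo-one+two s zero = refl
countUpTo-one+two s (suc m) =
  trans (interchange +-commutativeSemigroup (ind one (s m)) _ _ _)
        (cong₂ _+_ (ind-one+two (s m)) (countUpTo-one+two s m))

applyUpTo-cong : ∀ {A : Set} {f g : ℕ → A} → (∀ i → f i ≡ g i) → ∀ N → applyUpTo f N ≡ applyUpTo g N
applyUpTo-cong f≗g zero = refl
applyUpTo-cong f≗g (suc N) = cong₂ _∷_ (f≗g 0) (applyUpTo-cong (f≗g ∘ suc) N)

count-applyUpTo : ∀ c s N b →
  count c (applyUpTo (λ i → s (b + i)) N) + countUpTo c s b ≡ countUpTo c s (b + N)
count-applyUpTo c s zero b = cong (countUpTo c s) (sym (+-identityʳ b))
count-applyUpTo c s (suc N) b = begin
    count c (s (b + 0) ∷ rest) + countUpTo c s b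
  ≡⟨ cong (_+ countUpTo c s b) (count-∷ c (s (b + 0)) rest) ⟩
    (ind c (s (b + 0)) + count c rest) + countUpTo c s b
  ≡⟨ cong (λ z → (ind c (s z) + count c rest) + countUpTo c s b) (+-identityʳ b) ⟩
    (ind c (s b) + count c rest) + countUpTo c s b
  ≡⟨ cong (_+ countUpTo c s b) (+-comm (ind c (s b)) _) ⟩
    (count c rest + ind c (s b)) + countUpTo c s b
  ≡⟨ +-assoc (count c rest) _ _ ⟩
    count c rest + countUpTo c s (suc b)
  ≡⟨ cong (λ l → count c l + countUpTo c s (suc b)) (applyUpTo-cong (λ i → cong s (+-suc b i)) N) ⟩
    count c (applyUpTo (λ i → s (suc b + i)) N) + countUpTo c s (suc b)
  ≡⟨ count-applyUpTo c s N (suc b) ⟩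
    countUpTo c s (suc b + N)
  ≡⟨ cong (countUpTo c s) (sym (+-suc b N)) ⟩
    countUpTo c s (b + suc N) ∎
  where
  open ≡-Reasoning
  rest : List Two
  rest = applyUpTo (λ i → s (b + suc i)) N

count-block : ∀ c s N k → count c (block s N k) + countUpTo c s (k * N) ≡ countUpTo c s (k * N + N)
count-block c s N k =
  trans (cong (λ l → count c l + countUpTo c s (k * N)) (map-applyUpTo id (λ i → s (k * N + i)) N))
        (count-applyUpTo c s N (k * N))

↭-sorted : ∀ xs → xs ↭ replicate (count one xs) one ++ replicate (count two xs) two
↭-sorted [] = ↭-refl
↭-sorted (one ∷ xs) = prep one (↭-sorted xs)
↭-sorted (two ∷ xs) =
  ↭-trans (prep two (↭-sorted xs)) (↭-sym (shift two (replicate (count one xs) one) _))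

↭-from-counts : ∀ {xs ys} → (∀ c → count c xs ≡ count c ys) → xs ↭ ys
↭-from-counts {xs} {ys} eq = ↭-trans (↭-sorted xs)
  (↭-trans (↭-reflexive (cong₂ (λ a b → replicate a one ++ replicate b two) (eq one) (eq two)))
           (↭-sym (↭-sorted ys)))

blocks-↭ : ∀ s t N → (∀ c k → countUpTo c s (k * N) ≡ countUpTo c t (k * N)) →
  ∀ k → block s N k ↭ block t N k
blocks-↭ s t N eq k = ↭-from-counts λ c → +-cancelʳ-≡ (countUpTo c s (k * N)) _ _ (begin
    count c (block s N k) + countUpTo c s (k * N)  ≡⟨ count-block c s N k ⟩
    countUpTo c s (k * N + N)                      ≡⟨ cong (countUpTo c s) (+-comm (k * N) N) ⟩
    countUpTo c s (suc k * N)                      ≡⟨ eq c (suc k) ⟩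
    countUpTo c t (suc k * N)                      ≡⟨ cong (countUpTo c t) (+-comm N (k * N)) ⟩
    countUpTo c t (k * N + N)                      ≡⟨ count-block c t N k ⟨
    count c (block t N k) + countUpTo c t (k * N)  ≡⟨ cong (count c (block t N k) +_) (eq c k) ⟨
    count c (block t N k) + countUpTo c s (k * N)  ∎)
  where open ≡-Reasoning

↭-unmap : ∀ {A B : Set} (f : A → B) (f⁻ : B → A) → (∀ x → f⁻ (f x) ≡ x) →
  ∀ {xs ys} → map f xs ↭ map f ys → xs ↭ ys
↭-unmap f f⁻ f⁻∘f {xs} {ys} fxs↭fys = subst₂ _↭_ (map-cancel xs) (map-cancel ys) (map⁺ f⁻ fxs↭fys)
  where
  map-cancel : ∀ zs → map f⁻ (map f zs) ≡ zs
  map-cancel [] = refl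
  map-cancel (z ∷ zs) = cong₂ _∷_ (f⁻∘f z) (map-cancel zs)

block-∘ : ∀ {A B : Set} (g : A → B) (s : Seq A) N k → block (g ∘ s) N k ≡ map g (block s N k)
block-∘ g s N k = map-∘ (upTo N)

countUpTo-balanced : ∀ n r → (∀ k → count one (block r (2 * n) k) ≡ count two (block r (2 * n) k)) →
  ∀ c k → countUpTo c r (k * (2 * n)) ≡ k * n
countUpTo-balanced n r balanced c zero = refl
countUpTo-balanced n r balanced c (suc k) = begin
    countUpTo c r (2 * n + k * (2 * n))                 ≡⟨ cong (countUpTo c r) (+-comm (2 * n) _) ⟩
    countUpTo c r (k * (2 * n) + 2 * n)                 ≡⟨ count-block c r (2 * n) k ⟨
    count c (block r (2 * n) k) + countUpTo c r (k * (2 * n))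
                                                        ≡⟨ cong₂ _+_ (count-block-half c) (countUpTo-balanced n r balanced c k) ⟩
    n + k * n ∎
  where
  open ≡-Reasoning
  xs : List Two
  xs = block r (2 * n) k
  count-one : count one xs ≡ n
  count-one = *-cancelˡ-≡ _ n 2 (begin
    count one xs + (count one xs + 0)  ≡⟨ cong (count one xs +_) (trans (+-identityʳ _) (balanced k)) ⟩
    count one xs + count two xs        ≡⟨ count-one+two xs ⟩
    length xs                          ≡⟨ length-map _ (upTo (2 * n)) ⟩
    length (upTo (2 * n))              ≡⟨ length-applyUpTo id (2 * n) ⟩
    2 * n                              ∎)
  count-block-half : ∀ c → count c xs ≡ n
  count-block-half one = count-one
  count-block-half two = trans (sym (balanced k)) count-one

-- The subsequence of symbols emitted by a stream in which each step emits at most one symbol.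
module Emitted {A : Set} (out : ℕ → Maybe A) where

  emits : Maybe A → ℕ
  emits nothing = 0
  emits (just _) = 1

  emitsLabelled : (A → Two) → Two → Maybe A → ℕ
  emitsLabelled g c nothing = 0
  emitsLabelled g c (just z) = ind c (g z)

  emittedBefore : ℕ → ℕ
  emittedBefore zero = 0
  emittedBefore (suc a) = emits (out a) + emittedBefore a

  labelledBefore : (A → Two) → Two → ℕ → ℕ
  labelledBefore g c zero = 0
  labelledBefore g c (suc a) = emitsLabelled g c (out a) + labelledBefore g c a

  emittedBefore-split : ∀ g a → emittedBefore a ≡ labelledBefore g one a + labelledBefore g two a
  emittedBefore-split g zero = refl
  emittedBefore-split g (suc a) =
    trans (cong₂ _+_ (emits-split (out a)) (emittedBefore-split g a))
          (interchange +-commutativeSemigroup (emitsLabelled g one (out a)) _ _ _)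
    where
    emits-split : ∀ w → emits w ≡ emitsLabelled g one w + emitsLabelled g two w
    emits-split nothing = refl
    emits-split (just z) = sym (ind-one+two (g z))

  emittedBefore-mono : ∀ {a b} → a ≤′ b → emittedBefore a ≤ emittedBefore b
  emittedBefore-mono (≤′-reflexive refl) = ≤-refl
  emittedBefore-mono (≤′-step a≤b) = ≤-trans (emittedBefore-mono a≤b) (m≤n+m _ _)

  emittedBefore-suc : ∀ {a z} → out a ≡ just z → emittedBefore (suc a) ≡ suc (emittedBefore a)
  emittedBefore-suc e rewrite e = refl

  emission-unique : ∀ {a a' z z'} → out a ≡ just z → out a' ≡ just z' →
    emittedBefore a ≡ emittedBefore a' → a ≡ a'
  emission-unique {a} {a'} e e' eq with <-cmp a a'
  ... | tri≈ _ a≡a' _ = a≡a'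
  ... | tri< a<a' _ _ = ⊥-elim (<⇒≱ (subst (_≤ emittedBefore a') (emittedBefore-suc e)
                                       (emittedBefore-mono (≤⇒≤′ a<a'))) (≤-reflexive (sym eq)))
  ... | tri> _ _ a>a' = ⊥-elim (<⇒≱ (subst (_≤ emittedBefore a) (emittedBefore-suc e')
                                       (emittedBefore-mono (≤⇒≤′ a>a'))) (≤-reflexive eq))

  Emission : ℕ → Set
  Emission m = Σ ℕ λ a → emittedBefore a ≡ m × Σ A λ z → out a ≡ just z

  find-emission : ∀ N m → m < emittedBefore N → Emission m
  find-emission zero m ()
  find-emission (suc N) m m<e with out N in e
  ... | nothing = find-emission N m m<e
  ... | just z with m <? emittedBefore N
  ...   | yes m<e' = find-emission N m m<e'
  ...   | no m≮e' = N , ≤-antisym (≮⇒≥ m≮e') (≤-pred m<e) , z , e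

  module Unbounded (unbounded : ∀ m → Σ ℕ λ N → m < emittedBefore N) where

    emission : ∀ m → Emission m
    emission m = find-emission (proj₁ (unbounded m)) m (proj₂ (unbounded m))

    emitted : Seq A
    emitted m = proj₁ (proj₂ (proj₂ (emission m)))

    emitted-at : ∀ {a z} → out a ≡ just z → emitted (emittedBefore a) ≡ z
    emitted-at {a} e with emission (emittedBefore a)
    ... | a' , eq , z' , e' with emission-unique e e' (sym eq)
    ... | refl = just-injective (trans (sym e') e)

    countUpTo-emitted : ∀ g c a → countUpTo c (g ∘ emitted) (emittedBefore a) ≡ labelledBefore g c a
    countUpTo-emitted g c zero = refl
    countUpTo-emitted g c (suc a) with out a in e
    ... | nothing = countUpTo-emitted g c a
    ... | just z = cong₂ _+_ (cong (ind c ∘ g) (emitted-at e)) (countUpTo-emitted g c a)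

module Compressed {A : Set} (out : ℕ → Maybe A) (g : A → Two) (r : Seq Two) (n : ℕ) .{{_ : NonZero n}}
  (labelled : ∀ c k → Emitted.labelledBefore out g c (k * (2 * n)) ≡ countUpTo c r (k * n)) where
  open Emitted out

  emittedBefore-blocks : ∀ k → emittedBefore (k * (2 * n)) ≡ k * n
  emittedBefore-blocks k = begin
    emittedBefore (k * (2 * n))                                             ≡⟨ emittedBefore-split g (k * (2 * n)) ⟩
    labelledBefore g one (k * (2 * n)) + labelledBefore g two (k * (2 * n)) ≡⟨ cong₂ _+_ (labelled one k) (labelled two k) ⟩
    countUpTo one r (k * n) + countUpTo two r (k * n)                       ≡⟨ countUpTo-one+two r (k * n) ⟩
    k * n                                                                   ∎
    where open ≡-Reasoning

  unbounded : ∀ m → Σ ℕ λ N → m < emittedBefore N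
  unbounded m = suc m * (2 * n) , subst (m <_) (sym (emittedBefore-blocks (suc m))) (m≤m*n (suc m) n)

  open Unbounded unbounded public using (emitted)

  blocks-emitted-↭ : ∀ k → block (g ∘ emitted) n k ↭ block r n k
  blocks-emitted-↭ = blocks-↭ (g ∘ emitted) r n λ c k → begin
    countUpTo c (g ∘ emitted) (k * n)                        ≡⟨ cong (countUpTo c (g ∘ emitted)) (emittedBefore-blocks k) ⟨
    countUpTo c (g ∘ emitted) (emittedBefore (k * (2 * n)))  ≡⟨ Unbounded.countUpTo-emitted unbounded g c (k * (2 * n)) ⟩
    labelledBefore g c (k * (2 * n))                         ≡⟨ labelled c k ⟩
    countUpTo c r (k * n)                                    ∎
    where open ≡-Reasoning

double : ℕ → ℕ
double zero = 0
double (suc a) = suc (suc (double a))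

-- Steps 2a and 2a+1 form round a: the (a+1)-th departure from the source, then a departure from
-- vertex 2 or 3, which is the only step of the round that can hit a target.
module Compressor (x y : Variant) (r : Seq Two) where

  config-double : ∀ a → config x y r (double a) ≡ cfg v1 a (countUpTo one r a) (countUpTo two r a)
  config-double zero = refl
  config-double (suc a) rewrite config-double a with r a
  ... | one = refl
  ... | two = refl

  output-double : ∀ a → output x y r (double a) ≡ nothing
  output-double a rewrite config-double a with r a
  ... | one = refl
  ... | two = refl

  roundOutput : ℕ → Maybe Tgt
  roundOutput a = output x y r (suc (double a))

  roundOutput-one : ∀ {a} → r a ≡ one → roundOutput a ≡ leave x t4 (r (countUpTo one r a))
  roundOutput-one {a} e rewrite config-double a | e = refl

  roundOutput-two : ∀ {a} → r a ≡ two → roundOutput a ≡ leave y t5 (r (countUpTo two r a))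
  roundOutput-two {a} e rewrite config-double a | e = refl

  open Emitted roundOutput public

  hits-suc : ∀ t → hits x y r (suc t) ≡ emits (output x y r t) + hits x y r t
  hits-suc t with output x y r t
  ... | just _ = refl
  ... | nothing = refl

  hits-double : ∀ a → hits x y r (double a) ≡ emittedBefore a
  hits-round : ∀ a → hits x y r (suc (double a)) ≡ emittedBefore a

  hits-double zero = refl
  hits-double (suc a) = trans (hits-suc (suc (double a))) (cong (emits (roundOutput a) +_) (hits-round a))

  hits-round a = trans (hits-suc (double a)) (cong₂ _+_ (cong emits (output-double a)) (hits-double a))

  isHitting : (unbounded : ∀ m → Σ ℕ λ N → m < emittedBefore N) →
    IsHitting x y r (Unbounded.emitted unbounded)
  isHitting unbounded m with Unbounded.emission unbounded m
  ... | a , emittedBefore-a≡m , _ , output≡just = suc (double a) , trans (hits-round a) emittedBefore-a≡m , output≡just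

toTwo : Tgt → Two
toTwo t4 = one
toTwo t5 = two

fromTwo : Two → Tgt
fromTwo one = t4
fromTwo two = t5

fromTwo∘toTwo : ∀ z → fromTwo (toTwo z) ≡ z
fromTwo∘toTwo t4 = refl
fromTwo∘toTwo t5 = refl

toTwo-injective : Injective _≡_ _≡_ toTwo
toTwo-injective {t4} {t4} _ = refl
toTwo-injective {t4} {t5} ()
toTwo-injective {t5} {t4} ()
toTwo-injective {t5} {t5} _ = refl

swapT : Tgt → Tgt
swapT t4 = t5
swapT t5 = t4

swapT-injective : Injective _≡_ _≡_ swapT
swapT-injective {t4} {t4} _ = refl
swapT-injective {t4} {t5} ()
swapT-injective {t5} {t4} ()
swapT-injective {t5} {t5} _ = refl

flip : Two → Two
flip one = two
flip two = one

module _ (r : Seq Two) where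
  open Compressor D U r

  labelledBefore-DU : ∀ c a → labelledBefore toTwo c a ≡ countUpTo c r (countUpTo c r a)
  labelledBefore-DU c zero = refl
  labelledBefore-DU c (suc a) with r a in e
  labelledBefore-DU one (suc a) | one rewrite roundOutput-one e with r (countUpTo one r a)
  ... | one = cong suc (labelledBefore-DU one a)
  ... | two = labelledBefore-DU one a
  labelledBefore-DU two (suc a) | one rewrite roundOutput-one e with r (countUpTo one r a)
  ... | one = labelledBefore-DU two a
  ... | two = labelledBefore-DU two a
  labelledBefore-DU one (suc a) | two rewrite roundOutput-two e with r (countUpTo two r a)
  ... | one = labelledBefore-DU one a
  ... | two = labelledBefore-DU one a
  labelledBefore-DU two (suc a) | two rewrite roundOutput-two e with r (countUpTo two r a)
  ... | one = labelledBefore-DU two a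
  ... | two = cong suc (labelledBefore-DU two a)

module _ (r : Seq Two) where
  open Compressor U D r

  labelledBefore-UD : ∀ c a → labelledBefore (toTwo ∘ swapT) c a ≡ countUpTo c r (countUpTo (flip c) r a)
  labelledBefore-UD c zero = refl
  labelledBefore-UD c (suc a) with r a in e
  labelledBefore-UD one (suc a) | one rewrite roundOutput-one e with r (countUpTo one r a)
  ... | one = labelledBefore-UD one a
  ... | two = labelledBefore-UD one a
  labelledBefore-UD two (suc a) | one rewrite roundOutput-one e with r (countUpTo one r a)
  ... | one = labelledBefore-UD two a
  ... | two = cong suc (labelledBefore-UD two a)
  labelledBefore-UD one (suc a) | two rewrite roundOutput-two e with r (countUpTo two r a)
  ... | one = cong suc (labelledBefore-UD one a)
  ... | two = labelledBefore-UD one a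
  labelledBefore-UD two (suc a) | two rewrite roundOutput-two e with r (countUpTo two r a)
  ... | one = labelledBefore-UD two a
  ... | two = labelledBefore-UD two a

-- The fundamental period is used only to exclude n = 0, and the normalisation r 0 ≡ one not at all.
theorem7p5 : (r : Seq Two) (p n : ℕ) →
    IsFundamentalPeriod r p → r 0 ≡ one → IsBalanced (2 * n) r p →
    Σ (Seq Tgt) λ ud → Σ (Seq Tgt) λ du →
      IsHitting U D r ud × IsHitting D U r du ×
      NEquiv ud n du × NEquiv du n r
theorem7p5 r p zero (0<p , _) _ ((m , p≡m*0) , _) = ⊥-elim (<⇒≢ 0<p (sym (trans p≡m*0 (*-zeroʳ m))))
theorem7p5 r p n@(suc _) _ _ (_ , balanced) =
  UD.emitted , DU.emitted ,
  Compressor.isHitting U D r UD.unbounded , Compressor.isHitting D U r DU.unbounded ,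
  (swapT , swapT-injective , blocks-ud↭du) ,
  (toTwo , toTwo-injective , DU.blocks-emitted-↭)
  where
  countUpTo-blocks : ∀ c k → countUpTo c r (k * (2 * n)) ≡ k * n
  countUpTo-blocks = countUpTo-balanced n r balanced

  module DU = Compressed (Compressor.roundOutput D U r) toTwo r n
    (λ c k → trans (labelledBefore-DU r c (k * (2 * n))) (cong (countUpTo c r) (countUpTo-blocks c k)))
  module UD = Compressed (Compressor.roundOutput U D r) (toTwo ∘ swapT) r n
    (λ c k → trans (labelledBefore-UD r c (k * (2 * n))) (cong (countUpTo c r) (countUpTo-blocks (flip c) k)))

  blocks-ud↭du : ∀ k → block (swapT ∘ UD.emitted) n k ↭ block DU.emitted n k
  blocks-ud↭du k = ↭-unmap toTwo fromTwo fromTwo∘toTwo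
    (subst₂ _↭_ (block-∘ toTwo (swapT ∘ UD.emitted) n k) (block-∘ toTwo DU.emitted n k)
      (↭-trans (UD.blocks-emitted-↭ k) (↭-sym (DU.blocks-emitted-↭ k))))
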